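{- Let $n\ge2$ and $0<k\le n/2$. (i) For each $0\le h\le k$, the restriction of the labelling function $\lambda$ to $\mathcal{B}^h_{n,k}$ is injective. (ii) The labelling function $\lambda:\mathcal{B}_{n,k}\to\Lambda_{n,k}$ is injective.
   Context: $V_{n,k}$ is the $\mathbb{Q}$-vector space with basis the squarefree degree-$k$ monomials in $x_1,\dots,x_n$, ordered lexicographically: for distinct $k$-subsets $I,J$ with $t=\min(I\,\Delta\,J)$, $x_I\prec x_J$ iff $t\in I$; a nonzero $v$ is positive if the $\prec$-minimal monomial in $v$ has positive coefficient. A $k$-root is a product $\prod_{r=1}^k(\pm x_{i_{2r-1}}\pm x_{i_{2r}})$ with independent signs and $2k$ distinct indices; it is positive if positive in $V_{n,k}$. Each positive $k$-root can be written uniquely up to order of factors as $\prod_{r=1}^k(x_{i_{2r-1}}\pm x_{i_{2r}})$ with $i_{2r-1}<i_{2r}$ (normal form); factors $(x_i+x_j)$ are symmetric, indices not appearing are unused. The height is the number of symmetric factors. A positive $k$-root has a defect if its normal form has, for some $i<j<r<s$: (i) factors $(x_i\pm x_r)$ and $(x_j\pm x_s)$; (ii) a factor $(x_i\pm x_s)$ and a symmetric factor $(x_j+x_r)$; (iii) a factor $(x_i\pm x_r)$ and an unused index $j$; or (iv) a symmetric factor $(x_i+x_j)$ and an unused index $r$. $\mathcal{B}_{n,k}$ is the set of positive $k$-roots with no defects and $\mathcal{B}^h_{n,k}$ its subset of height $h$. The label $\lambda(\alpha)$ of $\alpha\in\mathcal{B}_{n,k}$ is the word of length $n$ over $\{1,2\}$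 with $\lambda(\alpha)_j=2$ iff the normal form has a factor $(x_i-x_j)$ for some $i<j$. $\Lambda_{n,k}$ is the set of lattice words of length $n$ over $\{1,2\}$ (every initial segment has at least as many 1s as 2s) with at most $k$ occurrences of $2$. -}

module Defs where

open import Data.Nat using (ℕ; zero; suc; _+_; _<_; _≤_)
open import Data.Bool using (Bool; true; false; if_then_else_; _∧_; _∨_)
open import Data.List using (List; []; _∷_; length; map; upTo; take; concatMap)
open import Data.List.Membership.Propositional using (_∈_; _∉_)
open import Data.List.Relation.Unary.All using (All)
open import Data.List.Relation.Unary.Unique.Propositional using (Unique)
open import Data.List.Relation.Unary.Linked using (Linked)
open import Data.Product using (_×_; ∃-syntax)
open import Data.Sum using (_⊎_)
open import Data.Empty using (⊥)
open import Relation.Binary.PropositionalEquality using (_≡_)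

-- Indices: the variable x_{m+1} is encoded by the natural number m, so the
-- variables x_1 … x_n correspond to 0 … n-1 (the order is preserved).

data Sign : Set where
  plus minus : Sign

-- A factor (x_a ± x_b) of a normal form, with a < b.
record Factor : Set where
  constructor fac
  field
    fst : ℕ
    snd : ℕ
    sgn : Sign
open Factor public

-- A normal form, as a list of factors listed in increasing order of first index
-- (this fixes the "up to order of factors" ambiguity canonically).
indices : List Factor → List ℕ
indices = concatMap (λ f → fst f ∷ snd f ∷ [])

IsNF : ℕ → ℕ → List Factor → Set
IsNF n k fs =
  length fs ≡ k
  × All (λ f → fst f < snd f × snd f < n) fs
  × Unique (indices fs)
  × Linked (λ f g → fst f < fst g) fs

Unused : ℕ → List Factor → ℕ → Set
Unused n fs m = m < n × m ∉ indices fs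

HasFactor : List Factor → ℕ → ℕ → Set
HasFactor fs a b = ∃[ s ] (fac a b s ∈ fs)

HasSym : List Factor → ℕ → ℕ → Set
HasSym fs a b = fac a b plus ∈ fs

HasDefect : ℕ → List Factor → Set
HasDefect n fs =
  ∃[ i ] ∃[ j ] ∃[ r ] (i < j × j < r ×
    ( (∃[ s ] (r < s × HasFactor fs i r × HasFactor fs j s))
    ⊎ (∃[ s ] (r < s × HasFactor fs i s × HasSym fs j r))
    ⊎ (HasFactor fs i r × Unused n fs j)
    ⊎ (HasSym fs i j × Unused n fs r)))

InB : ℕ → ℕ → List Factor → Set
InB n k fs = IsNF n k fs × (HasDefect n fs → ⊥)

height : List Factor → ℕ
height [] = 0
height (fac _ _ plus ∷ fs) = suc (height fs)
height (fac _ _ minus ∷ fs) = height fs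

data Letter : Set where
  one two : Letter

minusEnd : ℕ → List Factor → Bool
minusEnd j [] = false
minusEnd j (fac _ b plus ∷ fs) = minusEnd j fs
minusEnd j (fac _ b minus ∷ fs) = (b Data.Nat.≡ᵇ j) ∨ minusEnd j fs

label : ℕ → List Factor → List Letter
label n fs = map (λ j → if minusEnd j fs then two else one) (upTo n)

count : Letter → List Letter → ℕ
count c [] = 0
count one (one ∷ w) = suc (count one w)
count one (two ∷ w) = count one w
count two (two ∷ w) = suc (count two w)
count two (one ∷ w) = count two w

InΛ : ℕ → ℕ → List Letter → Set
InΛ n k w =
  length w ≡ n
  × (∀ m → count two (take m w) ≤ count one (take m w))
  × count two w ≤ k

module Submission where

-- In a defect-free normal form every index strictly inside a factor is an endpoint of an
-- antisymmetric factor nested strictly inside it. Hence the antisymmetric factors are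
-- recovered from the label by induction on their right endpoint: the label says which
-- indices are right endpoints, and a wrong left partner would put an endpoint of a
-- nested (already recovered) factor in two different factors. The symmetric factors
-- are consecutive pairs, all lying to the right of the unused indices, so once the
-- antisymmetric factors and the height are known, the symmetric ones are the last
-- 2h indices not used by antisymmetric factors, paired in order. For the lattice
-- property, sending a letter 2 at position j to the left partner of j injects the
-- 2s of every prefix into its 1s.

open import Defs
open import Data.Nat using (ℕ; zero; suc; _+_; _*_; _≤_; _<_; _≡ᵇ_; _⊓_; z≤n; s≤s)
open import Data.Nat.Properties
  using (_≟_; ≤-refl; suc-injective; <-irrefl; <-trans; <-≤-trans; ≤-trans; ≤-pred; ≤-reflexive; <-cmp; +-suc; +-cancelʳ-≡; ≡ᵇ⇒≡)
open import Data.Bool using (true; false; T; _∨_; if_then_else_)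
open import Data.Bool.Properties using (∨-zeroʳ)
open import Data.List using (List; []; _∷_; length; map; upTo; applyUpTo; take; filter; _++_)
open import Data.List.Properties using (∷-injective; length-map; length-upTo; length-++; take-map; filter-notAll)
open import Data.List.Membership.Propositional using (_∈_; _∉_)
open import Data.List.Membership.Propositional.Properties
  using (∈-filter⁺; ∈-filter⁻; ∈-upTo⁺; ∈-upTo⁻; ∈-++⁺ˡ; ∈-++⁺ʳ; ∈-++⁻; ∈-map⁺)
open import Data.List.Membership.DecPropositional _≟_ using (_∈?_)
open import Data.List.Relation.Binary.Subset.Propositional using (_⊆_)
open import Data.List.Relation.Unary.All as All using (All; []; _∷_)
open import Data.List.Relation.Unary.Any as Any using (here; there)
open import Data.List.Relation.Unary.AllPairs using (AllPairs; []; _∷_)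
import Data.List.Relation.Unary.AllPairs.Properties as AllPairs
open import Data.List.Relation.Unary.Unique.Propositional using (Unique)
import Data.List.Relation.Unary.Unique.Propositional.Properties as Unique
open import Data.List.Relation.Unary.Linked.Properties using (Linked⇒AllPairs)
open import Data.Product using (_×_; _,_; proj₁; proj₂; ∃-syntax)
open import Data.Sum using (_⊎_; inj₁; inj₂)
open import Data.Empty using (⊥-elim)
open import Function using (_∘_)
open import Relation.Nullary using (¬_; yes; no)
open import Relation.Nullary.Decidable using (¬?)
open import Relation.Binary using (Irreflexive; Transitive; DecidableEquality; tri<; tri≈; tri>)
open import Relation.Binary.PropositionalEquality using (_≡_; refl; sym; trans; cong; subst; module ≡-Reasoning)
open ≡-Reasoning

module _ {A : Set} {R : A → A → Set} (irrefl : Irreflexive _≡_ R) (trans< : Transitive R) where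

  private
    tail-⊆ : ∀ {x xs ys} → All (R x) xs → (x ∷ xs) ⊆ (x ∷ ys) → xs ⊆ ys
    tail-⊆ x<xs xs⊆ z∈xs with xs⊆ (there z∈xs)
    ... | here refl = ⊥-elim (irrefl refl (All.lookup x<xs z∈xs))
    ... | there z∈ys = z∈ys

  strictlySorted-⊆⊇⇒≡ : ∀ {xs ys} → AllPairs R xs → AllPairs R ys → xs ⊆ ys → ys ⊆ xs → xs ≡ ys
  strictlySorted-⊆⊇⇒≡ {[]} {[]} _ _ _ _ = refl
  strictlySorted-⊆⊇⇒≡ {[]} {y ∷ ys} _ _ _ ys⊆ with () ← ys⊆ (here refl)
  strictlySorted-⊆⊇⇒≡ {x ∷ xs} {[]} _ _ xs⊆ _ with () ← xs⊆ (here refl)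
  strictlySorted-⊆⊇⇒≡ {x ∷ xs} {y ∷ ys} (x<xs ∷ sxs) (y<ys ∷ sys) xs⊆ ys⊆
    with xs⊆ (here refl) | ys⊆ (here refl)
  ... | here refl | _ = cong (x ∷_) (strictlySorted-⊆⊇⇒≡ sxs sys (tail-⊆ x<xs xs⊆) (tail-⊆ y<ys ys⊆))
  ... | there x∈ys | here refl = ⊥-elim (irrefl refl (All.lookup y<ys x∈ys))
  ... | there x∈ys | there y∈xs = ⊥-elim (irrefl refl (trans< (All.lookup x<xs y∈xs) (All.lookup y<ys x∈ys)))

module _ {A B : Set} (_≟ᴮ_ : DecidableEquality B) where

  injection⇒length≤ : ∀ (g : A → B) {xs ys} → Unique xs → (∀ {x} → x ∈ xs → g x ∈ ys) →
    (∀ {x y} → x ∈ xs → y ∈ xs → g x ≡ g y → x ≡ y) → length xs ≤ length ys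
  injection⇒length≤ g {[]} _ _ _ = z≤n
  injection⇒length≤ g {x ∷ xs} {ys} (x∉xs ∷ uxs) into inj =
    ≤-trans (s≤s (injection⇒length≤ g uxs into′ (λ p q → inj (there p) (there q))))
            (filter-notAll (λ y → ¬? (y ≟ᴮ g x)) ys (Any.map (λ gx≡y y≢gx → y≢gx (sym gx≡y)) (into (here refl))))
    where
    into′ : ∀ {z} → z ∈ xs → g z ∈ filter (λ y → ¬? (y ≟ᴮ g x)) ys
    into′ z∈ = ∈-filter⁺ (λ y → ¬? (y ≟ᴮ g x)) (into (there z∈))
                 (λ gz≡gx → All.lookup x∉xs z∈ (sym (inj (there z∈) (here refl) gz≡gx)))

++-cancelˡ-sameLength : ∀ {A : Set} (xs ys : List A) {as bs : List A} →
  length as ≡ length bs → xs ++ as ≡ ys ++ bs → as ≡ bs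
++-cancelˡ-sameLength xs ys {as} {bs} |as|≡|bs| eq = cancel xs ys |xs|≡|ys| eq
  where
  |xs|≡|ys| : length xs ≡ length ys
  |xs|≡|ys| = +-cancelʳ-≡ (length as) (length xs) (length ys) (begin
    length xs + length as  ≡⟨ length-++ xs ⟨
    length (xs ++ as)      ≡⟨ cong length eq ⟩
    length (ys ++ bs)      ≡⟨ length-++ ys ⟩
    length ys + length bs  ≡⟨ cong (length ys +_) |as|≡|bs| ⟨
    length ys + length as  ∎)
  cancel : ∀ (xs ys : List _) → length xs ≡ length ys → xs ++ as ≡ ys ++ bs → as ≡ bs
  cancel [] [] _ e = e
  cancel (x ∷ xs) (y ∷ ys) l e = cancel xs ys (suc-injective l) (proj₂ (∷-injective e))

AllPairs-mapWith∈ : ∀ {A : Set} {R S : A → A → Set} {xs} →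
  (∀ {x y} → x ∈ xs → y ∈ xs → R x y → S x y) → AllPairs R xs → AllPairs S xs
AllPairs-mapWith∈ f [] = []
AllPairs-mapWith∈ f (rx ∷ rxs) =
  All.tabulate (λ y∈ → f (here refl) (there y∈) (All.lookup rx y∈)) ∷ AllPairs-mapWith∈ (λ p q → f (there p) (there q)) rxs

take-applyUpTo : ∀ {A : Set} (f : ℕ → A) m n → take m (applyUpTo f n) ≡ applyUpTo f (m ⊓ n)
take-applyUpTo f zero n = refl
take-applyUpTo f (suc m) zero = refl
take-applyUpTo f (suc m) (suc n) = cong (f 0 ∷_) (take-applyUpTo (f ∘ suc) m n)

upTo-sorted : ∀ n → AllPairs _<_ (upTo n)
upTo-sorted n = AllPairs.applyUpTo⁺₁ (λ i → i) n (λ i<j _ → i<j)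

map≡map⇒≡ : ∀ {A C : Set} {f g : A → C} {xs x} → map f xs ≡ map g xs → x ∈ xs → f x ≡ g x
map≡map⇒≡ {xs = _ ∷ _} e (here refl) = proj₁ (∷-injective e)
map≡map⇒≡ {xs = _ ∷ _} e (there x∈) = map≡map⇒≡ (proj₂ (∷-injective e)) x∈

Endpoint : ℕ → Factor → Set
Endpoint x f = x ≡ fst f ⊎ x ≡ snd f

endpoint⇒∈indices : ∀ {fs f x} → f ∈ fs → Endpoint x f → x ∈ indices fs
endpoint⇒∈indices (here refl) (inj₁ refl) = here refl
endpoint⇒∈indices (here refl) (inj₂ refl) = there (here refl)
endpoint⇒∈indices (there f∈) e = there (there (endpoint⇒∈indices f∈ e))

∈indices⇒endpoint : ∀ {fs x} → x ∈ indices fs → ∃[ f ] (f ∈ fs × Endpoint x f)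
∈indices⇒endpoint {f ∷ fs} (here x≡a) = f , here refl , inj₁ x≡a
∈indices⇒endpoint {f ∷ fs} (there (here x≡b)) = f , here refl , inj₂ x≡b
∈indices⇒endpoint {f ∷ fs} (there (there x∈)) with g , g∈ , e ← ∈indices⇒endpoint x∈ = g , there g∈ , e

sharedEndpoint⇒≡ : ∀ {fs f g x} → Unique (indices fs) → f ∈ fs → g ∈ fs → Endpoint x f → Endpoint x g → f ≡ g
sharedEndpoint⇒≡ _ (here refl) (here refl) _ _ = refl
sharedEndpoint⇒≡ (a∉ ∷ b∉ ∷ _) (here refl) (there g∈) (inj₁ refl) e =
  ⊥-elim (All.lookup a∉ (there (endpoint⇒∈indices g∈ e)) refl)
sharedEndpoint⇒≡ (a∉ ∷ b∉ ∷ _) (here refl) (there g∈) (inj₂ refl) e =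
  ⊥-elim (All.lookup b∉ (endpoint⇒∈indices g∈ e) refl)
sharedEndpoint⇒≡ (a∉ ∷ b∉ ∷ _) (there f∈) (here refl) e (inj₁ refl) =
  ⊥-elim (All.lookup a∉ (there (endpoint⇒∈indices f∈ e)) refl)
sharedEndpoint⇒≡ (a∉ ∷ b∉ ∷ _) (there f∈) (here refl) e (inj₂ refl) =
  ⊥-elim (All.lookup b∉ (endpoint⇒∈indices f∈ e) refl)
sharedEndpoint⇒≡ (_ ∷ _ ∷ u) (there f∈) (there g∈) e e′ = sharedEndpoint⇒≡ u f∈ g∈ e e′

All-indices⁺ : ∀ {P : ℕ → Set} {fs} → All (λ f → P (fst f) × P (snd f)) fs → All P (indices fs)
All-indices⁺ [] = []
All-indices⁺ ((p , q) ∷ pqs) = p ∷ q ∷ All-indices⁺ pqs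

indices-sorted : ∀ {fs} → All (λ f → fst f < snd f) fs → AllPairs (λ f g → snd f < fst g) fs → AllPairs _<_ (indices fs)
indices-sorted [] [] = []
indices-sorted {f ∷ fs} (a<b ∷ ordered) (b<fs ∷ sequential) =
  (a<b ∷ All.map (<-trans a<b) b<rest) ∷ b<rest ∷ indices-sorted ordered sequential
  where
  b<rest : All (snd f <_) (indices fs)
  b<rest = All-indices⁺ (All.zipWith (λ (b<c , c<d) → b<c , <-trans b<c c<d) (b<fs , ordered))

length-indices : ∀ fs → length (indices fs) ≡ length fs + length fs
length-indices [] = refl
length-indices (f ∷ fs) = cong suc (trans (cong suc (length-indices fs)) (sym (+-suc _ _)))

_≟ˢ_ : DecidableEquality Sign
plus ≟ˢ plus = yes refl
minus ≟ˢ minus = yes refl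
plus ≟ˢ minus = no λ ()
minus ≟ˢ plus = no λ ()

ofSign : Sign → List Factor → List Factor
ofSign s = filter (λ f → sgn f ≟ˢ s)

∈ofSign⁺ : ∀ {f fs} → f ∈ fs → f ∈ ofSign (sgn f) fs
∈ofSign⁺ f∈ = ∈-filter⁺ (λ f → sgn f ≟ˢ _) f∈ refl

∈ofSign⁻ : ∀ {s f} fs → f ∈ ofSign s fs → f ∈ fs × sgn f ≡ s
∈ofSign⁻ fs = ∈-filter⁻ (λ f → sgn f ≟ˢ _) {xs = fs}

indices-ofSign-⊆ : ∀ s fs → indices (ofSign s fs) ⊆ indices fs
indices-ofSign-⊆ s fs z∈ with f , f∈ , e ← ∈indices⇒endpoint {ofSign s fs} z∈ =
  endpoint⇒∈indices (proj₁ (∈ofSign⁻ fs f∈)) e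

ofSign-sign : ∀ s fs → All (λ f → sgn f ≡ s) (ofSign s fs)
ofSign-sign s fs = All.tabulate (proj₂ ∘ ∈ofSign⁻ fs)

height≡length-ofSign-plus : ∀ fs → height fs ≡ length (ofSign plus fs)
height≡length-ofSign-plus [] = refl
height≡length-ofSign-plus (fac _ _ plus ∷ fs) = cong suc (height≡length-ofSign-plus fs)
height≡length-ofSign-plus (fac _ _ minus ∷ fs) = height≡length-ofSign-plus fs

length≡length-ofSign : ∀ fs → length fs ≡ length (ofSign plus fs) + length (ofSign minus fs)
length≡length-ofSign [] = refl
length≡length-ofSign (fac _ _ plus ∷ fs) = cong suc (length≡length-ofSign fs)
length≡length-ofSign (fac _ _ minus ∷ fs) = trans (cong suc (length≡length-ofSign fs)) (sym (+-suc _ _))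

indices-injective-sameSign : ∀ {s} fs gs → All (λ f → sgn f ≡ s) fs → All (λ g → sgn g ≡ s) gs →
  indices fs ≡ indices gs → fs ≡ gs
indices-injective-sameSign [] [] _ _ _ = refl
indices-injective-sameSign (fac a b _ ∷ fs) (fac _ _ _ ∷ gs) (refl ∷ sfs) (refl ∷ sgs) e
  with refl , e′ ← ∷-injective e with refl , e″ ← ∷-injective e′ =
  cong (fac a b _ ∷_) (indices-injective-sameSign fs gs sfs sgs e″)

_<ᶠ_ : Factor → Factor → Set
f <ᶠ g = fst f < fst g

<ᶠ-irrefl : Irreflexive _≡_ _<ᶠ_
<ᶠ-irrefl f≡g = <-irrefl (cong fst f≡g)

signParts-≡⇒≡ : ∀ {fs gs} → AllPairs _<ᶠ_ fs → AllPairs _<ᶠ_ gs → (∀ s → ofSign s fs ≡ ofSign s gs) → fs ≡ gs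
signParts-≡⇒≡ {fs} {gs} sfs sgs parts≡ =
  strictlySorted-⊆⊇⇒≡ <ᶠ-irrefl <-trans sfs sgs (move fs gs parts≡) (move gs fs (sym ∘ parts≡))
  where
  move : ∀ fs gs → (∀ s → ofSign s fs ≡ ofSign s gs) → fs ⊆ gs
  move fs gs parts≡ {f} f∈ = proj₁ (∈ofSign⁻ gs (subst (f ∈_) (parts≡ (sgn f)) (∈ofSign⁺ f∈)))

leftPartner : ℕ → List Factor → ℕ
leftPartner j [] = 0
leftPartner j (fac a b plus ∷ fs) = leftPartner j fs
leftPartner j (fac a b minus ∷ fs) = if b ≡ᵇ j then a else leftPartner j fs

minusEnd⇒leftPartner : ∀ j fs → minusEnd j fs ≡ true → fac (leftPartner j fs) j minus ∈ fs
minusEnd⇒leftPartner j (fac a b plus ∷ fs) e = there (minusEnd⇒leftPartner j fs e)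
minusEnd⇒leftPartner j (fac a b minus ∷ fs) e with b ≡ᵇ j in b≡ᵇj
... | true with refl ← ≡ᵇ⇒≡ b j (subst T (sym b≡ᵇj) _) = here refl
... | false = there (minusEnd⇒leftPartner j fs e)

≡ᵇ-refl : ∀ j → (j ≡ᵇ j) ≡ true
≡ᵇ-refl zero = refl
≡ᵇ-refl (suc j) = ≡ᵇ-refl j

minus∈⇒minusEnd : ∀ {a j fs} → fac a j minus ∈ fs → minusEnd j fs ≡ true
minus∈⇒minusEnd {j = j} {fs = _ ∷ fs} (here refl) = cong (_∨ minusEnd j fs) (≡ᵇ-refl j)
minus∈⇒minusEnd {fs = fac _ _ plus ∷ _} (there f∈) = minus∈⇒minusEnd f∈
minus∈⇒minusEnd {j = j} {fs = fac _ b minus ∷ _} (there f∈) =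
  trans (cong ((b ≡ᵇ j) ∨_) (minus∈⇒minusEnd f∈)) (∨-zeroʳ (b ≡ᵇ j))

letter : List Factor → ℕ → Letter
letter fs j = if minusEnd j fs then two else one

letter≡two⇒minusEnd : ∀ fs j → letter fs j ≡ two → minusEnd j fs ≡ true
letter≡two⇒minusEnd fs j e with minusEnd j fs
... | true = refl
letter≡two⇒minusEnd fs j () | false

letter-injective : ∀ fs gs j → letter fs j ≡ letter gs j → minusEnd j fs ≡ minusEnd j gs
letter-injective fs gs j e with minusEnd j fs | minusEnd j gs
... | true | true = refl
... | false | false = refl
letter-injective fs gs j () | true | false
letter-injective fs gs j () | false | true

SameMinusEnds : ℕ → List Factor → List Factor → Set
SameMinusEnds n fs gs = ∀ j → j < n → minusEnd j fs ≡ minusEnd j gs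

label≡⇒sameMinusEnds : ∀ n fs gs → label n fs ≡ label n gs → SameMinusEnds n fs gs
label≡⇒sameMinusEnds n fs gs e j j<n = letter-injective fs gs j (map≡map⇒≡ e (∈-upTo⁺ j<n))

_≟ᴸ_ : DecidableEquality Letter
one ≟ᴸ one = yes refl
two ≟ᴸ two = yes refl
one ≟ᴸ two = no λ ()
two ≟ᴸ one = no λ ()

count-map : ∀ {A : Set} c (f : A → Letter) xs → count c (map f xs) ≡ length (filter (λ x → f x ≟ᴸ c) xs)
count-map c f [] = refl
count-map one f (x ∷ xs) with f x
... | one = cong suc (count-map one f xs)
... | two = count-map one f xs
count-map two f (x ∷ xs) with f x
... | one = count-map two f xs
... | two = cong suc (count-map two f xs)

unusedIndices : ℕ → List Factor → List ℕ
unusedIndices n fs = filter (λ x → ¬? (x ∈? indices fs)) (upTo n)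

∈-unusedIndices⁺ : ∀ {n fs x} → Unused n fs x → x ∈ unusedIndices n fs
∈-unusedIndices⁺ {fs = fs} (x<n , x∉) = ∈-filter⁺ (λ x → ¬? (x ∈? indices fs)) (∈-upTo⁺ x<n) x∉

∈-unusedIndices⁻ : ∀ {n fs x} → x ∈ unusedIndices n fs → Unused n fs x
∈-unusedIndices⁻ {n} {fs} x∈ with x∈upTo , x∉ ← ∈-filter⁻ (λ x → ¬? (x ∈? indices fs)) {xs =
  upTo n} x∈ = ∈-upTo⁻ x∈upTo , x∉

unusedIndices-sorted : ∀ n fs → AllPairs _<_ (unusedIndices n fs)
unusedIndices-sorted n fs = AllPairs.filter⁺ _ (upTo-sorted n)

module DefectFree {n k : ℕ} {α : List Factor} (α∈B : InB n k α) where

  noDefect : ¬ HasDefect n α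
  noDefect = proj₂ α∈B

  bounds : ∀ {f} → f ∈ α → fst f < snd f × snd f < n
  bounds = All.lookup (proj₁ (proj₂ (proj₁ α∈B)))

  distinct : Unique (indices α)
  distinct = proj₁ (proj₂ (proj₂ (proj₁ α∈B)))

  sorted : AllPairs _<ᶠ_ α
  sorted = Linked⇒AllPairs <-trans (proj₂ (proj₂ (proj₂ (proj₁ α∈B))))

  endpoint<n : ∀ {f z} → f ∈ α → Endpoint z f → z < n
  endpoint<n f∈ (inj₁ refl) = <-trans (proj₁ (bounds f∈)) (proj₂ (bounds f∈))
  endpoint<n f∈ (inj₂ refl) = proj₂ (bounds f∈)

  index<n : ∀ {z} → z ∈ indices α → z < n
  index<n z∈ with _ , f∈ , e ← ∈indices⇒endpoint {α} z∈ = endpoint<n f∈ e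

  symmetricIndex∉minusIndices : ∀ {z} → z ∈ indices (ofSign plus α) → z ∉ indices (ofSign minus α)
  symmetricIndex∉minusIndices z∈P z∈M
    with f , f∈P , e ← ∈indices⇒endpoint {ofSign plus α} z∈P | g , g∈M , e′ ← ∈indices⇒endpoint {ofSign minus α} z∈M
    with f∈α , f-plus ← ∈ofSign⁻ α f∈P | g∈α , g-minus ← ∈ofSign⁻ α g∈M
    with () ← trans (sym f-plus) (trans (cong sgn (sharedEndpoint⇒≡ distinct f∈α g∈α e e′)) g-minus)

  leftEnd-notMinusEnd : ∀ {a b s} → fac a b s ∈ α → minusEnd a α ≡ false
  leftEnd-notMinusEnd {a} ab∈ with minusEnd a α in end
  ... | false = refl
  ... | true = ⊥-elim (<-irrefl (cong snd (sharedEndpoint⇒≡ distinct (minusEnd⇒leftPartner a α end) ab∈ (inj₂ refl) (inj₁ refl)))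
                                (proj₁ (bounds ab∈)))

  NestedMinus : ℕ → ℕ → ℕ → Set
  NestedMinus a b q = ∃[ x ] ∃[ y ] (fac x y minus ∈ α × Endpoint q (fac x y minus) × a < x × y < b)

  inner-nestedMinus : ∀ {a b s q} → fac a b s ∈ α → a < q → q < b → NestedMinus a b q
  inner-nestedMinus {a} {b} {s} {q} ab∈ a<q q<b with q ∈? indices α
  ... | no q∉ =
    ⊥-elim (noDefect (a , q , b , a<q , q<b , inj₂ (inj₂ (inj₁ ((s , ab∈) , <-trans q<b (proj₂ (bounds ab∈)) , q∉)))))
  ... | yes q∈ with ∈indices⇒endpoint q∈
  ...   | fac _ y t , qy∈ , inj₁ refl = asLeftEnd qy∈
    where
    asLeftEnd : ∀ {y t} → fac q y t ∈ α → NestedMinus a b q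
    asLeftEnd {y} {t} qy∈ with <-cmp y b
    ... | tri> _ _ b<y = ⊥-elim (noDefect (a , q , b , a<q , q<b , inj₁ (y , b<y , (s , ab∈) , (t , qy∈))))
    ... | tri≈ _ refl _ = ⊥-elim (<-irrefl (cong fst (sharedEndpoint⇒≡ distinct ab∈ qy∈ (inj₂ refl) (inj₂ refl))) a<q)
    asLeftEnd {y} {minus} qy∈ | tri< y<b _ _ = q , y , qy∈ , inj₁ refl , a<q , y<b
    asLeftEnd {y} {plus} qy∈ | tri< y<b _ _ =
      ⊥-elim (noDefect (a , q , y , a<q , proj₁ (bounds qy∈) , inj₂ (inj₁ (b , y<b , (s , ab∈) , qy∈))))
  ...   | fac x _ t , xq∈ , inj₂ refl = asRightEnd xq∈
    where
    asRightEnd : ∀ {x t} → fac x q t ∈ α → NestedMinus a b q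
    asRightEnd {x} {t} xq∈ with <-cmp x a
    ... | tri< x<a _ _ = ⊥-elim (noDefect (x , a , q , x<a , a<q , inj₁ (b , q<b , (t , xq∈) , (s , ab∈))))
    ... | tri≈ _ refl _ = ⊥-elim (<-irrefl (sym (cong snd (sharedEndpoint⇒≡ distinct ab∈ xq∈ (inj₁ refl) (inj₁ refl)))) q<b)
    asRightEnd {x} {minus} xq∈ | tri> _ _ a<x = x , q , xq∈ , inj₂ refl , a<x , q<b
    asRightEnd {x} {plus} xq∈ | tri> _ _ a<x =
      ⊥-elim (noDefect (a , x , q , a<x , proj₁ (bounds xq∈) , inj₂ (inj₁ (b , q<b , (s , ab∈) , xq∈))))

  symmetric-sequential : ∀ {a b c d} → fac a b plus ∈ α → fac c d plus ∈ α → a < c → b < c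
  symmetric-sequential {a} {b} {c} {d} ab∈ cd∈ a<c with <-cmp b c
  ... | tri< b<c _ _ = b<c
  ... | tri≈ _ refl _ = ⊥-elim (<-irrefl (cong fst (sharedEndpoint⇒≡ distinct ab∈ cd∈ (inj₂ refl) (inj₁ refl))) a<c)
  ... | tri> _ _ c<b with <-cmp d b
  ...   | tri< d<b _ _ = ⊥-elim (noDefect (a , c , d , a<c , proj₁ (bounds cd∈) , inj₂ (inj₁ (b , d<b , (plus , ab∈) , cd∈))))
  ...   | tri≈ _ refl _ = ⊥-elim (<-irrefl (cong fst (sharedEndpoint⇒≡ distinct ab∈ cd∈ (inj₂ refl) (inj₂ refl))) a<c)
  ...   | tri> _ _ b<d = ⊥-elim (noDefect (a , c , b , a<c , c<b , inj₁ (d , b<d , (plus , ab∈) , (plus , cd∈))))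

  unused<symmetric : ∀ {u c d} → Unused n α u → fac c d plus ∈ α → u < c
  unused<symmetric {u} {c} {d} (u<n , u∉) cd∈ with <-cmp u c
  ... | tri< u<c _ _ = u<c
  ... | tri≈ _ refl _ = ⊥-elim (u∉ (endpoint⇒∈indices cd∈ (inj₁ refl)))
  ... | tri> _ _ c<u with <-cmp u d
  ...   | tri< u<d _ _ with _ , _ , xy∈ , e , _ ← inner-nestedMinus cd∈ c<u u<d = ⊥-elim (u∉ (endpoint⇒∈indices xy∈ e))
  ...   | tri≈ _ refl _ = ⊥-elim (u∉ (endpoint⇒∈indices cd∈ (inj₂ refl)))
  ...   | tri> _ _ d<u = ⊥-elim (noDefect (c , d , u , proj₁ (bounds cd∈) , d<u , inj₂ (inj₂ (inj₂ (cd∈ , u<n , u∉)))))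

  symmetricIndices-sorted : AllPairs _<_ (indices (ofSign plus α))
  symmetricIndices-sorted =
    indices-sorted (All.tabulate (proj₁ ∘ bounds ∘ proj₁ ∘ ∈ofSign⁻ α))
                   (AllPairs-mapWith∈ sequential (AllPairs.filter⁺ _ sorted))
    where
    sequential : ∀ {f g} → f ∈ ofSign plus α → g ∈ ofSign plus α → f <ᶠ g → snd f < fst g
    sequential {fac _ _ _} {fac _ _ _} f∈ g∈ with f∈α , refl ← ∈ofSign⁻ α f∈ | g∈α , refl ← ∈ofSign⁻ α g∈ =
      symmetric-sequential f∈α g∈α

  unusedIndices<symmetricIndices : All (λ u → All (u <_) (indices (ofSign plus α))) (unusedIndices n α)
  unusedIndices<symmetricIndices = All.tabulate λ u∈ → All.tabulate λ z∈ → below (∈-unusedIndices⁻ {n} {α} u∈) (∈indices⇒endpoint z∈)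
    where
    below : ∀ {u z} → Unused n α u → ∃[ f ] (f ∈ ofSign plus α × Endpoint z f) → u < z
    below u-unused (fac _ _ _ , f∈ , e) with f∈α , refl ← ∈ofSign⁻ α f∈ with e
    ... | inj₁ refl = unused<symmetric u-unused f∈α
    ... | inj₂ refl = <-trans (unused<symmetric u-unused f∈α) (proj₁ (bounds f∈α))

  unusedBy-minus≡unused++symmetric : unusedIndices n (ofSign minus α) ≡ unusedIndices n α ++ indices (ofSign plus α)
  unusedBy-minus≡unused++symmetric =
    strictlySorted-⊆⊇⇒≡ <-irrefl <-trans (unusedIndices-sorted n (ofSign minus α))
      (AllPairs.++⁺ (unusedIndices-sorted n α) symmetricIndices-sorted unusedIndices<symmetricIndices) forward backward
    where
    forward : unusedIndices n (ofSign minus α) ⊆ unusedIndices n α ++ indices (ofSign plus α)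
    forward {z} z∈ with z<n , z∉M ← ∈-unusedIndices⁻ {n} {ofSign minus α} z∈ with z ∈? indices α
    ... | no z∉α = ∈-++⁺ˡ (∈-unusedIndices⁺ {n} {α} (z<n , z∉α))
    ... | yes z∈α with ∈indices⇒endpoint {α} z∈α
    ...   | fac _ _ plus , f∈ , e = ∈-++⁺ʳ (unusedIndices n α) (endpoint⇒∈indices (∈ofSign⁺ f∈) e)
    ...   | fac _ _ minus , f∈ , e = ⊥-elim (z∉M (endpoint⇒∈indices (∈ofSign⁺ f∈) e))
    backward : unusedIndices n α ++ indices (ofSign plus α) ⊆ unusedIndices n (ofSign minus α)
    backward z∈ with ∈-++⁻ (unusedIndices n α) z∈
    ... | inj₁ z∈U with z<n , z∉α ← ∈-unusedIndices⁻ {n} {α} z∈U =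
      ∈-unusedIndices⁺ {n} {ofSign minus α} (z<n , z∉α ∘ indices-ofSign-⊆ minus α)
    ... | inj₂ z∈P =
      ∈-unusedIndices⁺ {n} {ofSign minus α} (index<n (indices-ofSign-⊆ plus α z∈P) , symmetricIndex∉minusIndices z∈P)

  twoPositions onePositions : ℕ → List ℕ
  twoPositions p = filter (λ j → letter α j ≟ᴸ two) (upTo p)
  onePositions p = filter (λ j → letter α j ≟ᴸ one) (upTo p)

  twoPosition⇒minus : ∀ {p j} → j ∈ twoPositions p → j < p × fac (leftPartner j α) j minus ∈ α
  twoPosition⇒minus {p} {j} j∈ with j∈upTo , is-two ← ∈-filter⁻ (λ j → letter α j ≟ᴸ two) {xs = upTo p} j∈ =
    ∈-upTo⁻ j∈upTo , minusEnd⇒leftPartner j α (letter≡two⇒minusEnd α j is-two)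

  twos≤ones : ∀ p → length (twoPositions p) ≤ length (onePositions p)
  twos≤ones p = injection⇒length≤ _≟_ (λ j → leftPartner j α) (Unique.filter⁺ _ (Unique.upTo⁺ p)) into injective
    where
    into : ∀ {j} → j ∈ twoPositions p → leftPartner j α ∈ onePositions p
    into j∈ with j<p , ij∈ ← twoPosition⇒minus {p} j∈ =
      ∈-filter⁺ (λ j → letter α j ≟ᴸ one) (∈-upTo⁺ (<-trans (proj₁ (bounds ij∈)) j<p))
                (cong (λ b → if b then two else one) (leftEnd-notMinusEnd ij∈))
    injective : ∀ {j j′} → j ∈ twoPositions p → j′ ∈ twoPositions p → leftPartner j α ≡ leftPartner j′ α → j ≡ j′
    injective j∈ j′∈ i≡i′ =
      cong snd (sharedEndpoint⇒≡ distinct (proj₂ (twoPosition⇒minus {p} j∈)) (proj₂ (twoPosition⇒minus {p} j′∈)) (inj₁ refl) (inj₁ i≡i′))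

  twos≤k : length (twoPositions n) ≤ k
  twos≤k = ≤-trans (injection⇒length≤ _≟_ (λ j → j) (Unique.filter⁺ _ (Unique.upTo⁺ n)) into (λ _ _ j≡j′ → j≡j′))
                   (≤-reflexive (trans (length-map snd α) (proj₁ (proj₁ α∈B))))
    where
    into : ∀ {j} → j ∈ twoPositions n → j ∈ map snd α
    into j∈ = ∈-map⁺ snd (proj₂ (twoPosition⇒minus {n} j∈))

  label∈Λ : InΛ n k (label n α)
  label∈Λ =
    trans (length-map (letter α) (upTo n)) (length-upTo n) , lattice
    , subst (_≤ k) (sym (count-map two (letter α) (upTo n))) twos≤k
    where
    lattice : ∀ m → count two (take m (label n α)) ≤ count one (take m (label n α))
    lattice m rewrite take-map {f = letter α} m (upTo n) | take-applyUpTo (λ i → i) m n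
                    | count-map two (letter α) (upTo (m ⊓ n)) | count-map one (letter α) (upTo (m ⊓ n)) = twos≤ones (m ⊓ n)

module SameMinusEndsTransfer {n k : ℕ} {α β : List Factor} (α∈B : InB n k α) (β∈B : InB n k β)
                             (sameEnds : SameMinusEnds n α β) where
  private
    module Α = DefectFree α∈B
    module Β = DefectFree β∈B

  -- The bound d makes this a strong induction on the right endpoint b.
  minus-transfer : ∀ d {a b} → b < d → fac a b minus ∈ α → fac a b minus ∈ β
  minus-transfer (suc d) {a} {b} b≤d ab∈α = resolve (minusEnd⇒leftPartner b β bEndβ)
    where
    bEndβ : minusEnd b β ≡ true
    bEndβ = trans (sym (sameEnds b (proj₂ (Α.bounds ab∈α)))) (minus∈⇒minusEnd ab∈α)
    nested : ∀ {x y} → y < b → fac x y minus ∈ α → fac x y minus ∈ β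
    nested y<b = minus-transfer d (<-≤-trans y<b (≤-pred b≤d))
    resolve : ∀ {a′} → fac a′ b minus ∈ β → fac a b minus ∈ β
    resolve {a′} a′b∈β with <-cmp a a′
    ... | tri≈ _ refl _ = a′b∈β
    ... | tri< a<a′ _ _ with x , y , xy∈α , e , _ , y<b ← Α.inner-nestedMinus ab∈α a<a′ (proj₁ (Β.bounds a′b∈β)) =
      ⊥-elim (<-irrefl (cong snd (sharedEndpoint⇒≡ Β.distinct (nested y<b xy∈α) a′b∈β e (inj₁ refl))) y<b)
    ... | tri> _ _ a′<a with Β.inner-nestedMinus a′b∈β a′<a (proj₁ (Α.bounds ab∈α))
    ...   | _ , y , ay∈β , inj₁ refl , _ , y<b
          with _ , _ , uv∈α , e , a<u , v<b ← Α.inner-nestedMinus ab∈α (proj₁ (Β.bounds ay∈β)) y<b =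
      ⊥-elim (<-irrefl (cong fst (sharedEndpoint⇒≡ Β.distinct ay∈β (nested v<b uv∈α) (inj₂ refl) e)) a<u)
    ...   | _ , _ , xa∈β , inj₂ refl , _ =
      ⊥-elim (true≢false (trans (sym (minus∈⇒minusEnd xa∈β))
                                (trans (sym (sameEnds a (Α.endpoint<n ab∈α (inj₁ refl)))) (Α.leftEnd-notMinusEnd ab∈α))))
      where
      true≢false : ¬ true ≡ false
      true≢false ()

minusFactors-≡ : ∀ {n k α β} → InB n k α → InB n k β → SameMinusEnds n α β → ofSign minus α ≡ ofSign minus β
minusFactors-≡ {n} {k} {α} {β} α∈B β∈B sameEnds =
  strictlySorted-⊆⊇⇒≡ <ᶠ-irrefl <-trans
    (AllPairs.filter⁺ _ (DefectFree.sorted α∈B)) (AllPairs.filter⁺ _ (DefectFree.sorted β∈B))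
    (transfer α∈B β∈B sameEnds) (transfer β∈B α∈B (λ j j<n → sym (sameEnds j j<n)))
  where
  transfer : ∀ {γ δ} → InB n k γ → InB n k δ → SameMinusEnds n γ δ → ofSign minus γ ⊆ ofSign minus δ
  transfer {γ} γ∈B δ∈B same {fac a b _} f∈ with f∈γ , refl ← ∈ofSign⁻ γ f∈ =
    ∈ofSign⁺ (SameMinusEndsTransfer.minus-transfer γ∈B δ∈B same (suc b) (s≤s ≤-refl) f∈γ)

symmetricFactors-≡ : ∀ {n k α β} → InB n k α → InB n k β → height α ≡ height β →
  ofSign minus α ≡ ofSign minus β → ofSign plus α ≡ ofSign plus β
symmetricFactors-≡ {n} {α = α} {β} α∈B β∈B hα≡hβ minus≡ =
  indices-injective-sameSign _ _ (ofSign-sign plus α) (ofSign-sign plus β)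
    (++-cancelˡ-sameLength (unusedIndices n α) (unusedIndices n β) sameLength
      (trans (sym (DefectFree.unusedBy-minus≡unused++symmetric α∈B))
        (trans (cong (unusedIndices n) minus≡) (DefectFree.unusedBy-minus≡unused++symmetric β∈B))))
  where
  sameLength : length (indices (ofSign plus α)) ≡ length (indices (ofSign plus β))
  sameLength rewrite length-indices (ofSign plus α) | length-indices (ofSign plus β)
                   | sym (height≡length-ofSign-plus α) | sym (height≡length-ofSign-plus β) | hα≡hβ = refl

label-injective-sameHeight : ∀ {n k α β} → InB n k α → InB n k β →
  height α ≡ height β → label n α ≡ label n β → α ≡ β
label-injective-sameHeight {n} {α = α} {β} α∈B β∈B hα≡hβ label≡ =
  signParts-≡⇒≡ (DefectFree.sorted α∈B) (DefectFree.sorted β∈B) λ where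
    plus → symmetricFactors-≡ α∈B β∈B hα≡hβ minus≡
    minus → minus≡
  where
  minus≡ : ofSign minus α ≡ ofSign minus β
  minus≡ = minusFactors-≡ α∈B β∈B (label≡⇒sameMinusEnds n α β label≡)

label-injective : ∀ {n k α β} → InB n k α → InB n k β → label n α ≡ label n β → α ≡ β
label-injective {n} {α = α} {β} α∈B β∈B label≡ = label-injective-sameHeight α∈B β∈B hα≡hβ label≡
  where
  minus≡ : ofSign minus α ≡ ofSign minus β
  minus≡ = minusFactors-≡ α∈B β∈B (label≡⇒sameMinusEnds n α β label≡)
  hα≡hβ : height α ≡ height β
  hα≡hβ = begin
    height α                                            ≡⟨ height≡length-ofSign-plus α ⟩
    length (ofSign plus α)                              ≡⟨ +-cancelʳ-≡ (length (ofSign minus α)) _ _ sums≡ ⟩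
    length (ofSign plus β)                              ≡⟨ height≡length-ofSign-plus β ⟨
    height β                                            ∎
    where
    sums≡ : length (ofSign plus α) + length (ofSign minus α) ≡ length (ofSign plus β) + length (ofSign minus α)
    sums≡ = begin
      length (ofSign plus α) + length (ofSign minus α)  ≡⟨ length≡length-ofSign α ⟨
      length α                                          ≡⟨ trans (proj₁ (proj₁ α∈B)) (sym (proj₁ (proj₁ β∈B))) ⟩
      length β                                          ≡⟨ length≡length-ofSign β ⟩
      length (ofSign plus β) + length (ofSign minus β)  ≡⟨ cong (length (ofSign plus β) +_) (cong length minus≡) ⟨
      length (ofSign plus β) + length (ofSign minus α)  ∎

lemma3p9 : (n k : ℕ) → 2 ≤ n → 1 ≤ k → 2 * k ≤ n →
    ((h : ℕ) → h ≤ k → (α β : List Factor) →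
      InB n k α → InB n k β → height α ≡ h → height β ≡ h →
      label n α ≡ label n β → α ≡ β)
    × ((α : List Factor) → InB n k α → InΛ n k (label n α))
    × ((α β : List Factor) → InB n k α → InB n k β →
      label n α ≡ label n β → α ≡ β)
lemma3p9 n k _ _ _ =
    (λ h _ α β α∈B β∈B hα hβ → label-injective-sameHeight α∈B β∈B (trans hα (sym hβ)))
  , (λ α → DefectFree.label∈Λ)
  , (λ α β → label-injective)
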